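{- Let $X=\{x_1,\dots,x_n\}$ be a finite set, $\mu$ a fuzzy measure on $X$, and $A\subset X$. Then $A$ is a set of indifference for $\mu$ if and only if for all $B_1,B_2\subset A$ with $|B_1|=|B_2|$ and all $C\subset X\setminus (B_1\cup B_2)$ we have $\mu(B_1\cup C)=\mu(B_2\cup C)$.
   Context: A fuzzy measure on a finite set $X$ is a set function $\mu:\mathcal P(X)\to[0,1]$ with $\mu(\emptyset)=0$, $\mu(X)=1$, and $A\subset B\Rightarrow \mu(A)\le\mu(B)$. A subset $A\subset X$ is a set of indifference for $\mu$ if for all $B_1,B_2\subset A$ with $|B_1|=|B_2|$ and all $C\subset X\setminus A$, $\mu(B_1\cup C)=\mu(B_2\cup C)$. -}

module Defs where

open import Level using (0ℓ)
open import Data.Nat using (ℕ)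
open import Data.Fin.Subset using (Subset; _⊆_; _∪_; ∁; ⊥; ⊤; ∣_∣)
open import Relation.Binary.Bundles using (Poset)
open import Relation.Binary.PropositionalEquality using (_≡_)

-- Values of a fuzzy measure: the paper uses the real interval [0,1].
-- Agda's stdlib has no reals, so we take an arbitrary poset with two
-- distinguished elements 𝟘 and 𝟙 (for [0,1] ⊂ ℝ: 𝟘 = 0, 𝟙 = 1).
-- Since μ is monotone with μ ∅ = 𝟘 and μ X = 𝟙, all values lie in [𝟘,𝟙].
module _ (P : Poset 0ℓ 0ℓ 0ℓ) (𝟘 𝟙 : Poset.Carrier P) where
  open Poset P

  record FuzzyMeasure (n : ℕ) : Set where
    field
      μ     : Subset n → Carrier
      μ-∅   : μ ⊥ ≈ 𝟘
      μ-X   : μ ⊤ ≈ 𝟙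
      mono  : ∀ {A B : Subset n} → A ⊆ B → μ A ≤ μ B

  IsSetOfIndifference : ∀ {n} → FuzzyMeasure n → Subset n → Set
  IsSetOfIndifference {n} m A =
    ∀ (B₁ B₂ C : Subset n) → B₁ ⊆ A → B₂ ⊆ A → ∣ B₁ ∣ ≡ ∣ B₂ ∣ →
      C ⊆ ∁ A → FuzzyMeasure.μ m (B₁ ∪ C) ≈ FuzzyMeasure.μ m (B₂ ∪ C)

  IndifferenceCondition : ∀ {n} → FuzzyMeasure n → Subset n → Set
  IndifferenceCondition {n} m A =
    ∀ (B₁ B₂ C : Subset n) → B₁ ⊆ A → B₂ ⊆ A → ∣ B₁ ∣ ≡ ∣ B₂ ∣ →
      C ⊆ ∁ (B₁ ∪ B₂) → FuzzyMeasure.μ m (B₁ ∪ C) ≈ FuzzyMeasure.μ m (B₂ ∪ C)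

module Submission where

-- (⇐) Since B₁ ∪ B₂ ⊆ A, every C ⊆ X ∖ A also satisfies C ⊆ X ∖ (B₁ ∪ B₂).
-- (⇒) Given C ⊆ X ∖ (B₁ ∪ B₂), split it along A into D = C ∩ A and
--     E = C ∩ (X ∖ A), so that Bᵢ ∪ C = (Bᵢ ∪ D) ∪ E.  The sets Bᵢ ∪ D lie
--     in A, and since D is disjoint from both Bᵢ they have the same size
--     |Bᵢ| + |D|; as E ⊆ X ∖ A, indifference of A gives the claim.

open import Defs
open import Level using (0ℓ)
open import Data.Nat using (ℕ; suc; _+_)
open import Data.Nat.Properties using (+-suc)
open import Data.Fin.Subset using (Subset; _⊆_; _∪_; _∩_; ∁; ∣_∣; ⊤; outside; inside)
open import Data.Fin.Subset.Properties
  using ( p⊆p∪q; q⊆p∪q; x∈p∪q⁻; p∩q⊆p; p∩q⊆q; drop-∷-⊆; p⊆q⇒∁p⊇∁q; ⊆-trans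
        ; ∪-assoc; ∪-inverseʳ; ∩-identityʳ; ∩-distribˡ-∪ )
open import Data.Vec using ([]; _∷_; here)
open import Data.Sum using (inj₁; inj₂)
open import Relation.Binary.Bundles using (Poset)
open import Relation.Binary.PropositionalEquality
  using (_≡_; refl; cong; sym; subst₂; module ≡-Reasoning)
open import Function.Bundles using (_⇔_; mk⇔)

∪-least : ∀ {n} {p q r : Subset n} → p ⊆ r → q ⊆ r → p ∪ q ⊆ r
∪-least {p = p} {q} p⊆r q⊆r x∈p∪q with x∈p∪q⁻ p q x∈p∪q
... | inj₁ x∈p = p⊆r x∈p
... | inj₂ x∈q = q⊆r x∈q

∣∪∣-disjoint : ∀ {n} (p q : Subset n) → q ⊆ ∁ p → ∣ p ∪ q ∣ ≡ ∣ p ∣ + ∣ q ∣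
∣∪∣-disjoint []             []             _   = refl
∣∪∣-disjoint (inside  ∷ p) (inside  ∷ q) q⊆∁p with q⊆∁p here
... | ()
∣∪∣-disjoint (inside  ∷ p) (outside ∷ q) q⊆∁p = cong suc (∣∪∣-disjoint p q (drop-∷-⊆ q⊆∁p))
∣∪∣-disjoint (outside ∷ p) (inside  ∷ q) q⊆∁p = begin
  suc ∣ p ∪ q ∣       ≡⟨ cong suc (∣∪∣-disjoint p q (drop-∷-⊆ q⊆∁p)) ⟩
  suc (∣ p ∣ + ∣ q ∣) ≡⟨ +-suc ∣ p ∣ ∣ q ∣ ⟨
  ∣ p ∣ + suc ∣ q ∣   ∎
  where open ≡-Reasoning
∣∪∣-disjoint (outside ∷ p) (outside ∷ q) q⊆∁p = ∣∪∣-disjoint p q (drop-∷-⊆ q⊆∁p)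

∪-split-along : ∀ {n} (A B C : Subset n) → B ∪ C ≡ (B ∪ (C ∩ A)) ∪ (C ∩ ∁ A)
∪-split-along A B C = begin
  B ∪ C                       ≡⟨ cong (B ∪_) (∩-identityʳ C) ⟨
  B ∪ (C ∩ ⊤)                 ≡⟨ cong (λ X → B ∪ (C ∩ X)) (∪-inverseʳ A) ⟨
  B ∪ (C ∩ (A ∪ ∁ A))         ≡⟨ cong (B ∪_) (∩-distribˡ-∪ C A (∁ A)) ⟩
  B ∪ ((C ∩ A) ∪ (C ∩ ∁ A))   ≡⟨ ∪-assoc B (C ∩ A) (C ∩ ∁ A) ⟨
  (B ∪ (C ∩ A)) ∪ (C ∩ ∁ A)   ∎
  where open ≡-Reasoning

module _ (P : Poset 0ℓ 0ℓ 0ℓ) (𝟘 𝟙 : Poset.Carrier P) {n : ℕ}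
         (m : FuzzyMeasure P 𝟘 𝟙 n) (A : Subset n) where
  open Poset P using (_≈_)
  open FuzzyMeasure m using (μ)

  condition⇒indifference : IndifferenceCondition P 𝟘 𝟙 m A → IsSetOfIndifference P 𝟘 𝟙 m A
  condition⇒indifference cond B₁ B₂ C B₁⊆A B₂⊆A ∣B₁∣≡∣B₂∣ C⊆∁A =
    cond B₁ B₂ C B₁⊆A B₂⊆A ∣B₁∣≡∣B₂∣ (⊆-trans C⊆∁A (p⊆q⇒∁p⊇∁q (∪-least B₁⊆A B₂⊆A)))

  indifference⇒condition : IsSetOfIndifference P 𝟘 𝟙 m A → IndifferenceCondition P 𝟘 𝟙 m A
  indifference⇒condition indiff B₁ B₂ C B₁⊆A B₂⊆A ∣B₁∣≡∣B₂∣ C⊆∁B₁∪B₂ =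
    subst₂ (λ X Y → μ X ≈ μ Y) (sym (∪-split-along A B₁ C)) (sym (∪-split-along A B₂ C))
      (indiff (B₁ ∪ D) (B₂ ∪ D) (C ∩ ∁ A)
              (∪-least B₁⊆A (p∩q⊆q C A)) (∪-least B₂⊆A (p∩q⊆q C A))
              ∣B₁∪D∣≡∣B₂∪D∣ (p∩q⊆q C (∁ A)))
    where
    D : Subset n
    D = C ∩ A

    D-avoids : ∀ {B} → B ⊆ B₁ ∪ B₂ → D ⊆ ∁ B
    D-avoids B⊆B₁∪B₂ = ⊆-trans (p∩q⊆p C A) (⊆-trans C⊆∁B₁∪B₂ (p⊆q⇒∁p⊇∁q B⊆B₁∪B₂))

    ∣B₁∪D∣≡∣B₂∪D∣ : ∣ B₁ ∪ D ∣ ≡ ∣ B₂ ∪ D ∣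
    ∣B₁∪D∣≡∣B₂∪D∣ = begin
      ∣ B₁ ∪ D ∣       ≡⟨ ∣∪∣-disjoint B₁ D (D-avoids (p⊆p∪q B₂)) ⟩
      ∣ B₁ ∣ + ∣ D ∣   ≡⟨ cong (_+ ∣ D ∣) ∣B₁∣≡∣B₂∣ ⟩
      ∣ B₂ ∣ + ∣ D ∣   ≡⟨ ∣∪∣-disjoint B₂ D (D-avoids (q⊆p∪q B₁ B₂)) ⟨
      ∣ B₂ ∪ D ∣       ∎
      where open ≡-Reasoning

lemma3p1 : (P : Poset 0ℓ 0ℓ 0ℓ) (𝟘 𝟙 : Poset.Carrier P) (n : ℕ)
           (m : FuzzyMeasure P 𝟘 𝟙 n) (A : Subset n) →
           IsSetOfIndifference P 𝟘 𝟙 m A ⇔ IndifferenceCondition P 𝟘 𝟙 m A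
lemma3p1 P 𝟘 𝟙 n m A =
  mk⇔ (indifference⇒condition P 𝟘 𝟙 m A) (condition⇒indifference P 𝟘 𝟙 m A)
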